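{- Let $G$ be a $4$-chordal graph with $t\ge 1$ maximal $3$-cliques. Then every nice tree-decomposition of $G$ has at least $t+2$ branches.
   Context: All graphs are finite and simple. A clique is a complete subgraph; a $k$-clique is a clique on $k$ vertices; a clique is maximal if it is inclusion-wise maximal among complete subgraphs. A graph is chordal if it has no induced cycle of length at least four; a chordal graph is $4$-chordal if every edge lies in a $4$-clique. A tree-decomposition of a graph $G$ is a tree $T$ with a set $V_u\subseteq V(G)$ associated with each node $u$ such that: two vertices $v,v'$ are adjacent in $G$ iff some node $u$ has $\{v,v'\}\subseteq V_u$; and for every vertex $v$, the nodes $u$ with $v\in V_u$ induce a subtree of $T$. Node $u$ corresponds to the clique induced by $V_u$. A tree-decomposition of a $4$-chordal graph is nice if it is rooted and: (1) no two adjacent nodes are associated with the same set; (2) every node $u$ has $|V_u|\ge 3$, and if $|V_u|=3$ then $V_u$ induces a maximal clique; (3) if $|V_u|=k\ge 5$ and $u$ is not the root, then $k-1$ vertices of $V_u$ belong to the set of the parent of $u$; (4) if $G$ has a maximal $3$-clique, the root corresponds to a maximal $3$-clique. A branch of a nice tree-decomposition is a rooted subtree with root node $r$ such that: $r$ corresponds to a $4$-clique; $r$ has a parent and the set associated with the parent of $r$ shares two vertices with $V_r$; the subtree consists of $r$ and all its descendants; and no descendant of $r$ corresponds to a $3$-clique. -}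

module Defs where

open import Data.Nat using (ℕ; zero; suc; _+_; _≤_; _<_; _%_)
open import Data.Fin using (Fin; toℕ)
open import Data.Fin.Subset using (Subset; _∈_; _⊆_; _∩_; ∣_∣)
open import Data.Product using (Σ; ∃; ∃-syntax; _×_; _,_)
open import Data.Sum using (_⊎_)
open import Data.List using (List; length)
open import Data.List.Relation.Unary.Unique.Propositional using (Unique)
import Data.List.Membership.Propositional as LM
open import Relation.Nullary using (¬_; Dec)
open import Relation.Binary.PropositionalEquality using (_≡_; _≢_)
open import Function.Bundles using (_⇔_)

record Graph : Set₁ where
  field
    n      : ℕ
    Adj    : Fin n → Fin n → Set
    adj?   : ∀ u v → Dec (Adj u v)
    sym    : ∀ {u v} → Adj u v → Adj v u
    irrefl : ∀ {u} → ¬ Adj u u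

module _ (G : Graph) where
  open Graph G

  IsClique : Subset n → Set
  IsClique S = ∀ u v → u ∈ S → v ∈ S → u ≢ v → Adj u v

  IsKClique : ℕ → Subset n → Set
  IsKClique k S = IsClique S × ∣ S ∣ ≡ k

  IsMaximalClique : Subset n → Set
  IsMaximalClique S = IsClique S × (∀ S' → IsClique S' → S ⊆ S' → S' ⊆ S)

  IsMaximal3Clique : Subset n → Set
  IsMaximal3Clique S = IsMaximalClique S × ∣ S ∣ ≡ 3

  CycAdj : ∀ {m} → Fin (4 + m) → Fin (4 + m) → Set
  CycAdj {m} i j = (suc (toℕ i) % (4 + m) ≡ toℕ j) ⊎ (suc (toℕ j) % (4 + m) ≡ toℕ i)

  record InducedCycle (m : ℕ) : Set where
    field
      c     : Fin (4 + m) → Fin n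
      inj   : ∀ i j → c i ≡ c j → i ≡ j
      edges : ∀ i j → Adj (c i) (c j) ⇔ CycAdj i j

  IsChordal : Set
  IsChordal = ∀ m → ¬ InducedCycle m

  Is4Chordal : Set
  Is4Chordal = IsChordal × (∀ u v → Adj u v → ∃[ S ] (IsKClique 4 S × u ∈ S × v ∈ S))

  -- The tree T has node set Fin m, a root,
  -- and a parent function (meaningful on non-root nodes); the edges of T
  -- are {u , parent u} for u ≢ root.  The depth function witnesses that
  -- following parents always reaches the root, i.e. T is a rooted tree.

  record RootedTD : Set where
    field
      m        : ℕ
      root     : Fin m
      parent   : Fin m → Fin m
      depth    : Fin m → ℕ
      depth-<  : ∀ u → u ≢ root → depth (parent u) < depth u
      bag      : Fin m → Subset n

    TAdj : Fin m → Fin m → Set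
    TAdj u w = (u ≢ root × parent u ≡ w) ⊎ (w ≢ root × parent w ≡ u)

    data Reach (P : Fin m → Set) : Fin m → Fin m → Set where
      here : ∀ {u} → Reach P u u
      step : ∀ {u w x} → TAdj u w → P w → Reach P w x → Reach P u x

    InducesSubtree : (Fin m → Set) → Set
    InducesSubtree P = (∃[ u ] P u) × (∀ u w → P u → P w → Reach P u w)

    data Desc (r : Fin m) : Fin m → Set where
      child : ∀ {w} → w ≢ root → parent w ≡ r → Desc r w
      below : ∀ {w x} → x ≢ root → parent x ≡ w → Desc r w → Desc r x

  module _ (T : RootedTD) where
    open RootedTD T

    IsTreeDecomposition : Set
    IsTreeDecomposition =
      (∀ v v' → v ≢ v' → (Adj v v' ⇔ (∃[ u ] (v ∈ bag u × v' ∈ bag u))))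
      × (∀ v → InducesSubtree (λ u → v ∈ bag u))

    IsNice : Set
    IsNice =
      IsTreeDecomposition
      -- (1) adjacent nodes carry different sets
      × (∀ u → u ≢ root → bag u ≢ bag (parent u))
      -- (2) bags have ≥ 3 vertices; bags of size 3 are maximal cliques
      × (∀ u → 3 ≤ ∣ bag u ∣ × (∣ bag u ∣ ≡ 3 → IsMaximalClique (bag u)))
      -- (3) a non-root node with k ≥ 5 shares (at least) k-1 vertices with its parent
      × (∀ u → u ≢ root → 5 ≤ ∣ bag u ∣ → ∣ bag u ∣ ≤ suc ∣ bag u ∩ bag (parent u) ∣)
      -- (4) if G has a maximal 3-clique, the root is a maximal 3-clique
      × ((∃[ S ] IsMaximal3Clique S) → IsMaximal3Clique (bag root))

    -- r is the root of a branch (a branch is determined by its root r: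
    -- it is r together with all its descendants)
    IsBranchRoot : Fin m → Set
    IsBranchRoot r =
      ∣ bag r ∣ ≡ 4
      × r ≢ root
      × ∣ bag r ∩ bag (parent r) ∣ ≡ 2
      × (∀ w → Desc r w → ∣ bag w ∣ ≢ 3)

    HasAtLeastBranches : ℕ → Set
    HasAtLeastBranches b =
      Σ (List (Fin m)) λ rs → Unique rs × (∀ r → r LM.∈ rs → IsBranchRoot r) × b ≤ length rs

  HasMaximal3Cliques : ℕ → Set
  HasMaximal3Cliques t =
    Σ (List (Subset n)) λ L → Unique L × (∀ S → S LM.∈ L ⇔ IsMaximal3Clique S) × length L ≡ t

-- Call a node of T a triangle node if its bag has three vertices.  Since the nodes
-- containing a vertex form a subtree and subtrees have the Helly property, every
-- maximal 3-clique is a bag, so there are at least t triangle nodes, and by nice (4)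
-- the root is one.  Let h be a triangle node and a a vertex whose subtree has its top
-- at h.  Each triangle edge ab at a lies in a 4-clique, whose fourth vertex x is not
-- in bag h; a bag containing a, b, x lies below h, so the child c of h towards it
-- contains a and b.  Either some triangle node lies in the subtree of c, or c is a
-- branch root (nice (2), (3) and maximality of bag h); call such children good.
-- Different edges give different children, as no child contains the whole triangle
-- (nice (1)).  Hence triangle nodes have two good children and the root has three.
-- Counting bottom-up, a node whose subtree contains a triangle node has strictly
-- below it more branch roots than triangle nodes in its subtree; at the root this
-- gives t + 2.

module Submission where

open import Defs
open import Data.Nat using (ℕ; _+_; _≤_)
open import Relation.Binary.Definitions using (DecidableEquality)
open import Data.Fin using (Fin)
open import Data.Fin.Properties using () renaming (_≟_ to _≟ᶠ_)
open import Data.Product using (_,_; proj₁)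

module Counting {A : Set} (_≟_ : DecidableEquality A) where

  open import Data.Nat using (ℕ; suc; _+_; _≤_; z≤n; s≤s)
  open import Data.Nat.Properties using (≤-refl; ≤-trans; ≤-reflexive; +-monoˡ-≤; +-mono-≤; +-suc; +-identityʳ; n≤0⇒n≡0)
  open import Data.Nat.Tactic.RingSolver using (solve-∀)
  open import Data.List using (List; []; _∷_; length; filter; map; _++_)
  open import Data.List.Properties using (length-++; length-map)
  open import Data.List.Relation.Unary.Any using (Any; here; there)
  open import Data.List.Relation.Unary.Unique.Propositional using (Unique)
  open import Data.List.Relation.Unary.Unique.Propositional.Properties using (filter⁺; map⁻) renaming (++⁺ to unique-++⁺)
  import Data.List.Relation.Unary.All as All
  open All using ([]; _∷_)
  open import Data.List.Relation.Unary.AllPairs using ([]; _∷_)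
  open import Data.List.Membership.Propositional using (_∈_; _∉_; find)
  open import Data.List.Membership.Propositional.Properties using (∈-filter⁻; ∈-++⁻; ∈-map⁺)
  open import Data.Product using (Σ; ∃; ∃₂; _×_; _,_; proj₂)
  open import Data.Sum using (_⊎_; inj₁; inj₂)
  open import Data.Empty using (⊥; ⊥-elim)
  open import Function using (_∘_)
  open import Relation.Nullary using (¬_; yes; no; ¬?)
  open import Relation.Unary using (Decidable)
  open import Relation.Binary.PropositionalEquality using (_≡_; _≢_; refl; sym; trans)

  AtLeast : (A → Set) → ℕ → Set
  AtLeast P k = Σ (List A) λ xs → Unique xs × (∀ x → x ∈ xs → P x) × k ≤ length xs

  length-filter-split : ∀ {R : A → Set} (R? : Decidable R) xs →
    length xs ≤ length (filter R? xs) + length (filter (¬? ∘ R?) xs)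
  length-filter-split R? [] = z≤n
  length-filter-split R? (x ∷ xs) with R? x
  ... | yes _ = s≤s (length-filter-split R? xs)
  ... | no _ = ≤-trans (s≤s (length-filter-split R? xs)) (≤-reflexive (sym (+-suc _ _)))

  unique-constant : ∀ {a : A} {xs : List A} → Unique xs → (∀ x → x ∈ xs → x ≡ a) → length xs ≤ 1
  unique-constant {xs = []} _ _ = z≤n
  unique-constant {xs = x ∷ []} _ _ = ≤-refl
  unique-constant {xs = x ∷ y ∷ _} ((x≢y ∷ _) ∷ _) all-a =
    ⊥-elim (x≢y (trans (all-a x (here refl)) (sym (all-a y (there (here refl))))))

  -- A duplicate-free list is no longer than any list containing all its entries
  -- (induction on the larger list, splitting off the copies of its head).
  unique-length-≤ : ∀ {xs : List A} ys → Unique xs → (∀ x → x ∈ xs → x ∈ ys) → length xs ≤ length ys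
  unique-length-≤ {xs} [] _ xs⊆[] with xs
  ... | [] = z≤n
  ... | x ∷ _ with xs⊆[] x (here refl)
  ...   | ()
  unique-length-≤ {xs} (y ∷ ys) u xs⊆ = ≤-trans (length-filter-split (_≟ y) xs)
    (+-mono-≤ (unique-constant {a = y} (filter⁺ (_≟ y) {xs} u) (λ x → proj₂ ∘ ∈-filter⁻ (_≟ y) {xs = xs}))
              (unique-length-≤ ys (filter⁺ (¬? ∘ (_≟ y)) {xs} u) others⊆))
    where
    others⊆ : ∀ x → x ∈ filter (¬? ∘ (_≟ y)) xs → x ∈ ys
    others⊆ x x∈ with ∈-filter⁻ (¬? ∘ (_≟ y)) x∈
    ... | x∈xs , x≢y with xs⊆ x x∈xs
    ...   | here x≡y = ⊥-elim (x≢y x≡y)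
    ...   | there x∈ys = x∈ys

  atLeast-≤ : ∀ {P k} ys → AtLeast P k → (∀ x → P x → x ∈ ys) → k ≤ length ys
  atLeast-≤ ys (xs , u , sat , k≤) P⊆ys = ≤-trans k≤ (unique-length-≤ ys u (λ x → P⊆ys x ∘ sat x))

  atLeast-map : ∀ {P Q : A → Set} {k} → (∀ {x} → P x → Q x) → AtLeast P k → AtLeast Q k
  atLeast-map f (xs , u , sat , k≤) = xs , u , (λ x → f ∘ sat x) , k≤

  atLeast-weaken : ∀ {P j k} → j ≤ k → AtLeast P k → AtLeast P j
  atLeast-weaken j≤k (xs , u , sat , k≤) = xs , u , sat , ≤-trans j≤k k≤

  atLeast-zero : ∀ {P} → AtLeast P 0
  atLeast-zero = [] , [] , (λ _ ()) , z≤n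

  atLeast-one : ∀ {P a} → P a → AtLeast P 1
  atLeast-one pa = _ ∷ [] , [] ∷ [] , (λ { _ (here refl) → pa }) , ≤-refl

  atLeast-two : ∀ {P x y} → x ≢ y → P x → P y → AtLeast P 2
  atLeast-two x≢y px py =
    _ ∷ _ ∷ [] , (x≢y ∷ []) ∷ [] ∷ [] , (λ { _ (here refl) → px ; _ (there (here refl)) → py }) , ≤-refl

  atLeast-three : ∀ {P x y z} → x ≢ y → x ≢ z → y ≢ z → P x → P y → P z → AtLeast P 3
  atLeast-three x≢y x≢z y≢z px py pz =
    _ ∷ _ ∷ _ ∷ [] , (x≢y ∷ x≢z ∷ []) ∷ (y≢z ∷ []) ∷ [] ∷ [] ,
    (λ { _ (here refl) → px ; _ (there (here refl)) → py ; _ (there (there (here refl))) → pz }) , ≤-refl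

  atLeast-none : ∀ {P k} → (∀ {x} → ¬ P x) → AtLeast P k → k ≡ 0
  atLeast-none ¬P ([] , _ , _ , k≤) = n≤0⇒n≡0 k≤
  atLeast-none ¬P (x ∷ _ , _ , sat , _) = ⊥-elim (¬P (sat x (here refl)))

  atLeast-∪ : ∀ {P Q : A → Set} {a b} → (∀ {x} → P x → Q x → ⊥) →
    AtLeast P a → AtLeast Q b → AtLeast (λ x → P x ⊎ Q x) (a + b)
  atLeast-∪ {P} {Q} disj (xs , uxs , satP , a≤) (ys , uys , satQ , b≤) =
    xs ++ ys ,
    unique-++⁺ uxs uys (λ (x∈xs , x∈ys) → disj (satP _ x∈xs) (satQ _ x∈ys)) ,
    (λ x x∈ → case (∈-++⁻ xs x∈)) ,
    ≤-trans (+-mono-≤ a≤ b≤) (≤-reflexive (sym (length-++ xs)))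
    where
    case : ∀ {x} → x ∈ xs ⊎ x ∈ ys → P x ⊎ Q x
    case (inj₁ x∈xs) = inj₁ (satP _ x∈xs)
    case (inj₂ x∈ys) = inj₂ (satQ _ x∈ys)

  atLeast-split : ∀ {P R : A → Set} {k} → Decidable R → AtLeast P k →
    ∃₂ λ k₁ k₂ → AtLeast (λ x → P x × R x) k₁ × AtLeast (λ x → P x × ¬ R x) k₂ × k ≤ k₁ + k₂
  atLeast-split {P} R? (xs , u , sat , k≤) =
    _ , _ ,
    (filter R? xs , filter⁺ R? u , part R? , ≤-refl) ,
    (filter (¬? ∘ R?) xs , filter⁺ _ u , part (¬? ∘ R?) , ≤-refl) ,
    ≤-trans k≤ (length-filter-split R? xs)
    where
    part : ∀ {S : A → Set} (S? : Decidable S) x → x ∈ filter S? xs → P x × S x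
    part S? x x∈ with ∈-filter⁻ S? x∈
    ... | x∈xs , sx = sat x x∈xs , sx

  atLeast-remove : ∀ {P k} a → AtLeast P k → ∃ λ k′ → AtLeast (λ x → P x × x ≢ a) k′ × k ≤ suc k′
  atLeast-remove a atl with atLeast-split (_≟ a) atl
  ... | k₁ , k₂ , copies , others , k≤ =
    k₂ , others , ≤-trans k≤ (+-monoˡ-≤ k₂ (atLeast-≤ (a ∷ []) copies (λ { x (_ , refl) → here refl })))

  -- Each "good" index c
  -- owns a decidable region Reg c; if every good region holds one more P-witness
  -- than Q-witnesses, then a list Cs of distinct good indices contributes, over
  -- the union of its regions, length Cs more P-witnesses than Q-witnesses.
  module _ {C : Set} (Good : C → Set) (Reg : C → A → Set) (Reg? : ∀ c → Decidable (Reg c))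
           (disjoint : ∀ {c c′ x} → Good c → Good c′ → c ≢ c′ → Reg c x → Reg c′ x → ⊥)
           {P Q : A → Set}
           (local : ∀ {c} → Good c → ∀ k →
              AtLeast (λ x → Q x × Reg c x) k → AtLeast (λ x → P x × Reg c x) (suc k)) where

    InUnion : List C → A → Set
    InUnion Cs x = Any (λ c → Reg c x) Cs

    gather : ∀ Cs → Unique Cs → (∀ c → c ∈ Cs → Good c) → ∀ k →
      AtLeast (λ x → Q x × InUnion Cs x) k → AtLeast (λ x → P x × InUnion Cs x) (k + length Cs)
    gather [] _ _ k atl =
      atLeast-weaken (≤-reflexive (trans (+-identityʳ k) (atLeast-none (λ { (_ , ()) }) atl))) atLeast-zero
    gather (c ∷ Cs) (c∉Cs ∷ uCs) good k atl with atLeast-split (Reg? c) atl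
    ... | k₁ , k₂ , inside , outside , k≤ =
      atLeast-weaken count
        (atLeast-map merge (atLeast-∪ separate
          (local (good c (here refl)) k₁ (atLeast-map (λ ((q , _) , r) → q , r) inside))
          (gather Cs uCs (λ c′ → good c′ ∘ there) k₂ (atLeast-map rest outside))))
      where
      rest : ∀ {x} → (Q x × InUnion (c ∷ Cs) x) × ¬ Reg c x → Q x × InUnion Cs x
      rest ((q , here r) , ¬r) = ⊥-elim (¬r r)
      rest ((q , there a) , _) = q , a

      merge : ∀ {x} → (P x × Reg c x) ⊎ (P x × InUnion Cs x) → P x × InUnion (c ∷ Cs) x
      merge (inj₁ (p , r)) = p , here r
      merge (inj₂ (p , a)) = p , there a

      separate : ∀ {x} → P x × Reg c x → P x × InUnion Cs x → ⊥
      separate (_ , r) (_ , a) with find a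
      ... | c′ , c′∈Cs , r′ = disjoint (good c (here refl)) (good c′ (there c′∈Cs))
                                (All.lookup c∉Cs c′∈Cs) r r′

      count : k + length (c ∷ Cs) ≤ suc k₁ + (k₂ + length Cs)
      count = ≤-trans (+-monoˡ-≤ (suc (length Cs)) k≤) (≤-reflexive (reassoc k₁ k₂ (length Cs)))
        where
        reassoc : ∀ a b n → (a + b) + suc n ≡ suc a + (b + n)
        reassoc = solve-∀

  image-of : ∀ {B : Set} (f : A → B) ys → (∀ y → y ∈ ys → ∃ λ x → f x ≡ y) → ∃ λ xs → map f xs ≡ ys
  image-of f [] _ = [] , refl
  image-of f (y ∷ ys) pre with pre y (here refl) | image-of f ys (λ y′ → pre y′ ∘ there)
  ... | x , refl | xs , refl = x ∷ xs , refl

  atLeast-preimage : ∀ {B : Set} (f : A → B) ys → Unique ys → (∀ y → y ∈ ys → ∃ λ x → f x ≡ y) →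
    AtLeast (λ x → f x ∈ ys) (length ys)
  atLeast-preimage f ys u pre with image-of f ys pre
  ... | xs , refl = xs , map⁻ u , (λ x → ∈-map⁺ f) , ≤-reflexive (length-map f xs)

module Subsets where

  open import Data.Nat using (zero; suc; _≤_; _<_; z≤n; s≤s)
  open import Data.Nat.Properties using (≤-trans; ≤-reflexive; ≤-pred; <⇒≱; n≤1+n)
  open import Data.Fin using (Fin; zero; suc)
  open import Data.Fin.Properties using (any?)
  open import Data.Fin.Subset using (Subset; _∈_; _∉_; _⊆_; _∩_; ∣_∣; _─_; _-_; ⁅_⁆; inside; outside)
  open import Data.Fin.Subset.Properties
    using (_∈?_; p⊆q⇒∣p∣≤∣q∣; p─⊥≡p; p─q⊆p; x∈p⇒∣p-x∣<∣p∣; x∈p∧x≢y⇒x∈p-y; ∣⁅x⁆∣≡1; x∉⁅y⁆⇒x≢y;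
           x∈p∩q⁺; p∩q⊆p; p∩q⊆q; ⊆-antisym; p⊂q⇒∣p∣<∣q∣; ∣⊥∣≡0)
  open import Data.Fin.Subset using () renaming (⊥ to ∅)
  open import Data.Vec using (_∷_; here; there)
  open import Data.List using (List; []; _∷_; length)
  open import Data.List.Relation.Unary.Unique.Propositional using (Unique)
  open import Data.List.Relation.Unary.All using ([]; _∷_; lookup)
  open import Data.List.Relation.Unary.AllPairs using ([]; _∷_)
  open import Data.List.Membership.Propositional using () renaming (_∈_ to _∈ₗ_)
  open import Data.List.Relation.Unary.Any using () renaming (here to hereₗ; there to thereₗ)
  open import Data.Product using (∃; ∃₂; _×_; _,_)
  open import Data.Empty using (⊥-elim)
  open import Relation.Nullary using (¬_; yes; no; ¬?)
  open import Function using (_∘_)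
  open import Relation.Nullary.Decidable using (_×-dec_)
  open import Relation.Binary.PropositionalEquality using (_≡_; _≢_; refl; sym; cong; subst; subst₂)

  ∣p∣≤1+∣p-x∣ : ∀ {n} (p : Subset n) (x : Fin n) → ∣ p ∣ ≤ suc ∣ p - x ∣
  ∣p∣≤1+∣p-x∣ (inside ∷ p) zero = s≤s (≤-reflexive (cong ∣_∣ (sym (p─⊥≡p p))))
  ∣p∣≤1+∣p-x∣ (outside ∷ p) zero = ≤-trans (≤-reflexive (cong ∣_∣ (sym (p─⊥≡p p)))) (n≤1+n _)
  ∣p∣≤1+∣p-x∣ (inside ∷ p) (suc x) = s≤s (∣p∣≤1+∣p-x∣ p x)
  ∣p∣≤1+∣p-x∣ (outside ∷ p) (suc x) = ∣p∣≤1+∣p-x∣ p x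

  x∈p─q⇒x∉q : ∀ {n} {x : Fin n} (p q : Subset n) → x ∈ p ─ q → x ∉ q
  x∈p─q⇒x∉q (_ ∷ p) (outside ∷ q) here ()
  x∈p─q⇒x∉q (_ ∷ p) (_ ∷ q) (there x∈) (there x∈q) = x∈p─q⇒x∉q p q x∈ x∈q

  ⊈-witness : ∀ {n} {p q : Subset n} → ¬ p ⊆ q → ∃ λ x → x ∈ p × x ∉ q
  ⊈-witness {p = p} {q} p⊈q with any? (λ x → x ∈? p ×-dec ¬? (x ∈? q))
  ... | yes witness = witness
  ... | no none = ⊥-elim (p⊈q p⊆q)
    where
    p⊆q : p ⊆ q
    p⊆q {x} x∈p with x ∈? q
    ... | yes x∈q = x∈q
    ... | no x∉q = ⊥-elim (none (x , x∈p , x∉q))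

  card-witness : ∀ {n} {p q : Subset n} → ∣ q ∣ < ∣ p ∣ → ∃ λ x → x ∈ p × x ∉ q
  card-witness q<p = ⊈-witness λ p⊆q → <⇒≱ q<p (p⊆q⇒∣p∣≤∣q∣ p⊆q)

  some-element : ∀ {n} {p : Subset n} → 0 < ∣ p ∣ → ∃ λ x → x ∈ p
  some-element {n} {p} 0<p with card-witness {p = p} {q = ∅} (subst (_< ∣ p ∣) (sym (∣⊥∣≡0 n)) 0<p)
  ... | x , x∈p , _ = x , x∈p

  length-≤-card : ∀ {n} (p : Subset n) {xs : List (Fin n)} → Unique xs → (∀ {x} → x ∈ₗ xs → x ∈ p) →
    length xs ≤ ∣ p ∣
  length-≤-card p {[]} _ _ = z≤n
  length-≤-card p {x ∷ xs} (x∉xs ∷ u) xs⊆p =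
    ≤-trans (s≤s (length-≤-card (p - x) u rest⊆)) (x∈p⇒∣p-x∣<∣p∣ (xs⊆p (hereₗ refl)))
    where
    rest⊆ : ∀ {y} → y ∈ₗ xs → y ∈ p - x
    rest⊆ y∈ = x∈p∧x≢y⇒x∈p-y (xs⊆p (thereₗ y∈)) (λ y≡x → lookup x∉xs y∈ (sym y≡x))

  ⊆-by-card : ∀ {n} {p q : Subset n} → p ⊆ q → ∣ q ∣ ≤ ∣ p ∣ → q ⊆ p
  ⊆-by-card {p = p} p⊆q q≤p {x} x∈q with x ∈? p
  ... | yes x∈p = x∈p
  ... | no x∉p = ⊥-elim (<⇒≱ (p⊂q⇒∣p∣<∣q∣ (p⊆q , x , x∈q , x∉p)) q≤p)

  three-elements : ∀ {n} {S : Subset n} {a} → ∣ S ∣ ≡ 3 → a ∈ S →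
    ∃₂ λ b c → b ∈ S × c ∈ S × a ≢ b × a ≢ c × b ≢ c
  three-elements {S = S} {a} ∣S∣≡3 a∈S
    with card-witness {p = S} {q = ⁅ a ⁆} (subst₂ _<_ (sym (∣⁅x⁆∣≡1 a)) (sym ∣S∣≡3) (s≤s (s≤s z≤n)))
  ... | b , b∈S , b∉⁅a⁆
    with card-witness {p = S - a} {q = ⁅ b ⁆}
           (subst (_< ∣ S - a ∣) (sym (∣⁅x⁆∣≡1 b)) (≤-pred (subst (_≤ suc ∣ S - a ∣) ∣S∣≡3 (∣p∣≤1+∣p-x∣ S a))))
  ... | c , c∈S-a , c∉⁅b⁆ =
    b , c , b∈S , p─q⊆p S ⁅ a ⁆ c∈S-a ,
    (λ a≡b → x∉⁅y⁆⇒x≢y b∉⁅a⁆ (sym a≡b)) ,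
    (λ a≡c → x∉⁅y⁆⇒x≢y (x∈p─q⇒x∉q S ⁅ a ⁆ c∈S-a) (sym a≡c)) ,
    (λ b≡c → x∉⁅y⁆⇒x≢y c∉⁅b⁆ (sym b≡c))

  triangle-⊆ : ∀ {n} {S X : Subset n} {a b c} → ∣ S ∣ ≡ 3 → a ≢ b → a ≢ c → b ≢ c →
    a ∈ S → b ∈ S → c ∈ S → a ∈ X → b ∈ X → c ∈ X → S ⊆ X
  triangle-⊆ {S = S} {X} {a} {b} {c} ∣S∣≡3 a≢b a≢c b≢c a∈S b∈S c∈S a∈X b∈X c∈X =
    p∩q⊆q S X ∘ ⊆-by-card (p∩q⊆p S X) (subst (_≤ ∣ S ∩ X ∣) (sym ∣S∣≡3) three≤)
    where
    three≤ : 3 ≤ ∣ S ∩ X ∣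
    three≤ = length-≤-card (S ∩ X) ((a≢b ∷ a≢c ∷ []) ∷ (b≢c ∷ []) ∷ [] ∷ [])
      λ { (hereₗ refl) → x∈p∩q⁺ (a∈S , a∈X)
        ; (thereₗ (hereₗ refl)) → x∈p∩q⁺ (b∈S , b∈X)
        ; (thereₗ (thereₗ (hereₗ refl))) → x∈p∩q⁺ (c∈S , c∈X) }

module Trees {G : Graph} (T : RootedTD G) where

  open import Data.Nat using (ℕ; zero; suc; _+_; _≤_; _<_)
  open import Data.Nat.Properties using (≤-reflexive; ≤-refl; ≤-trans; <-trans; ≤-pred; <⇒≤; <⇒≱; m≤n+m; m≤m+n; +-suc; +-monoˡ-≤; +-identityʳ)
  open import Data.Nat.ListAction using (sum)
  open import Data.Fin using (Fin)
  open import Data.Fin.Properties using (_≟_)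
  open import Data.List using (_∷_; map; allFin)
  open import Data.List.Membership.Propositional using (_∈_)
  open import Data.List.Membership.Propositional.Properties using (∈-allFin; ∈-map⁺)
  open import Data.List.Relation.Unary.Any using (here; there)
  open import Data.Product using (∃; _×_; _,_; proj₁; proj₂)
  open import Data.Sum using (_⊎_; inj₁; inj₂)
  open import Data.Empty using (⊥; ⊥-elim)
  open import Relation.Nullary using (¬_; Dec; yes; no; ¬?)
  open import Function using (_∘_)
  open import Relation.Nullary.Decidable using (_×-dec_; _⊎-dec_)
  open import Relation.Unary using (Decidable)
  open import Relation.Binary.PropositionalEquality using (_≡_; _≢_; refl; sym)

  open RootedTD T

  _⊑_ : Fin m → Fin m → Set
  a ⊑ w = a ≡ w ⊎ Desc a w

  parent-induction : (Q : Fin m → Set) → (∀ w → (w ≢ root → Q (parent w)) → Q w) → ∀ w → Q w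
  parent-induction Q up w = go (suc (depth w)) w ≤-refl
    where
    go : ∀ k w → depth w < k → Q w
    go (suc k) w w<k = up w λ w≢root → go k (parent w) (≤-trans (depth-< w w≢root) (≤-pred w<k))

  desc-depth : ∀ {a w} → Desc a w → depth a < depth w
  desc-depth (child {w} w≢root refl) = depth-< w w≢root
  desc-depth (below {x = x} x≢root refl d) = <-trans (desc-depth d) (depth-< x x≢root)

  ⊑-depth : ∀ {a w} → a ⊑ w → depth a ≤ depth w
  ⊑-depth (inj₁ refl) = ≤-refl
  ⊑-depth (inj₂ d) = <⇒≤ (desc-depth d)

  desc-⋢ : ∀ {a w} → Desc a w → ¬ (w ⊑ a)
  desc-⋢ d w⊑a = <⇒≱ (desc-depth d) (⊑-depth w⊑a)

  desc-parent : ∀ {a w} → Desc a w → w ≢ root × a ⊑ parent w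
  desc-parent (child w≢root refl) = w≢root , inj₁ refl
  desc-parent (below w≢root refl d) = w≢root , inj₂ d

  parent-desc : ∀ {a w} → a ⊑ parent w → w ≢ root → Desc a w
  parent-desc (inj₁ refl) w≢root = child w≢root refl
  parent-desc (inj₂ d) w≢root = below w≢root refl d

  desc-⊑-trans : ∀ {a b w} → Desc a b → b ⊑ w → Desc a w
  desc-⊑-trans d (inj₁ refl) = d
  desc-⊑-trans d (inj₂ (child w≢root refl)) = below w≢root refl d
  desc-⊑-trans d (inj₂ (below w≢root refl d′)) = below w≢root refl (desc-⊑-trans d (inj₂ d′))

  ⊑-trans : ∀ {a b w} → a ⊑ b → b ⊑ w → a ⊑ w
  ⊑-trans (inj₁ refl) b⊑w = b⊑w
  ⊑-trans (inj₂ d) b⊑w = inj₂ (desc-⊑-trans d b⊑w)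

  ⊑-≢ : ∀ {a w} → a ⊑ w → w ≢ a → Desc a w
  ⊑-≢ (inj₁ refl) w≢a = ⊥-elim (w≢a refl)
  ⊑-≢ (inj₂ d) _ = d

  root-⊑ : ∀ w → root ⊑ w
  root-⊑ = parent-induction (root ⊑_) up
    where
    up : ∀ w → (w ≢ root → root ⊑ parent w) → root ⊑ w
    up w ih with w ≟ root
    ... | yes refl = inj₁ refl
    ... | no w≢root = inj₂ (parent-desc (ih w≢root) w≢root)

  ⊑-comparable : ∀ {a b w} → a ⊑ w → b ⊑ w → a ⊑ b ⊎ b ⊑ a
  ⊑-comparable (inj₁ refl) b⊑w = inj₂ b⊑w
  ⊑-comparable (inj₂ d) b⊑w = desc-comparable d b⊑w
    where
    desc-comparable : ∀ {a b w} → Desc a w → b ⊑ w → a ⊑ b ⊎ b ⊑ a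
    desc-comparable d (inj₁ refl) = inj₁ (inj₂ d)
    desc-comparable (child _ refl) (inj₂ d′) = inj₂ (proj₂ (desc-parent d′))
    desc-comparable (below _ refl d) (inj₂ d′) = desc-comparable d (proj₂ (desc-parent d′))

  desc? : ∀ a → Decidable (Desc a)
  desc? a = parent-induction (λ w → Dec (Desc a w)) up
    where
    up : ∀ w → (w ≢ root → Dec (Desc a (parent w))) → Dec (Desc a w)
    up w ih with w ≟ root
    ... | yes w≡root = no λ d → proj₁ (desc-parent d) w≡root
    ... | no w≢root with parent w ≟ a | ih w≢root
    ...   | yes refl | _ = yes (child w≢root refl)
    ...   | no _ | yes d = yes (below w≢root refl d)
    ...   | no p≢a | no ¬d = no λ d′ → case (proj₂ (desc-parent d′))
      where
      case : a ⊑ parent w → ⊥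
      case (inj₁ a≡p) = p≢a (sym a≡p)
      case (inj₂ d) = ¬d d

  ⊑? : ∀ a → Decidable (a ⊑_)
  ⊑? a w = (a ≟ w) ⊎-dec desc? a w

  Child : Fin m → Fin m → Set
  Child h c = c ≢ root × parent c ≡ h

  child? : ∀ h → Decidable (Child h)
  child? h c = ¬? (c ≟ root) ×-dec (parent c ≟ h)

  child-desc : ∀ {h c} → Child h c → Desc h c
  child-desc (c≢root , refl) = child c≢root refl

  child-split : ∀ {h w} → Desc h w → ∃ λ c → Child h c × c ⊑ w
  child-split (child w≢root refl) = _ , (w≢root , refl) , inj₁ refl
  child-split (below x≢root refl d) with child-split d
  ... | c , ch , c⊑w = c , ch , inj₂ (parent-desc c⊑w x≢root)

  sibling-⋢ : ∀ {h c c′} → Child h c → Child h c′ → c′ ≢ c → ¬ (c ⊑ c′)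
  sibling-⋢ ch (_ , refl) c′≢c c⊑c′ =
    desc-⋢ (child-desc ch) (proj₂ (desc-parent (⊑-≢ c⊑c′ c′≢c)))

  children-disjoint : ∀ {h c c′ v} → Child h c → Child h c′ → c ≢ c′ → c ⊑ v → c′ ⊑ v → ⊥
  children-disjoint ch ch′ c≢c′ c⊑v c′⊑v with ⊑-comparable c⊑v c′⊑v
  ... | inj₁ c⊑c′ = sibling-⋢ ch ch′ (c≢c′ ∘ sym) c⊑c′
  ... | inj₂ c′⊑c = sibling-⋢ ch′ ch c≢c′ c′⊑c

  -- Induction from the leaves up; it terminates since depths are bounded.
  child-induction : (Q : Fin m → Set) → (∀ h → (∀ c → Child h c → Q c) → Q h) → ∀ h → Q h
  child-induction Q down h = go D h (m≤n+m D (depth h))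
    where
    D : ℕ
    D = sum (map depth (allFin m))

    ∈⇒≤sum : ∀ {x xs} → x ∈ xs → x ≤ sum xs
    ∈⇒≤sum {xs = x ∷ xs} (here refl) = m≤m+n x (sum xs)
    ∈⇒≤sum {xs = y ∷ xs} (there x∈) = ≤-trans (∈⇒≤sum x∈) (m≤n+m (sum xs) y)

    depth≤D : ∀ w → depth w ≤ D
    depth≤D w = ∈⇒≤sum (∈-map⁺ depth (∈-allFin w))

    child-depth : ∀ {h c} → Child h c → depth h < depth c
    child-depth ch = desc-depth (child-desc ch)

    go : ∀ k h → D ≤ depth h + k → Q h
    go zero h D≤ = down h λ c ch →
      ⊥-elim (<⇒≱ (child-depth ch) (≤-trans (depth≤D c) (≤-trans D≤ (≤-reflexive (+-identityʳ _)))))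
    go (suc k) h D≤ = down h λ c ch →
      go k c (≤-trans D≤ (≤-trans (≤-reflexive (+-suc (depth h) k)) (+-monoˡ-≤ k (child-depth ch))))

  record Subtree : Set₁ where
    field
      Holds : Fin m → Set
      holds? : Decidable Holds
      connected : InducesSubtree Holds

  open Subtree using (Holds)

  IsTop : Subtree → Fin m → Set
  IsTop S t = Holds S t × (t ≡ root ⊎ ¬ Holds S (parent t))

  module _ (S : Subtree) where
    open Subtree S hiding (Holds)

    climb : ∀ {t u} → t ≡ root ⊎ ¬ Holds S (parent t) → u ≢ root → Holds S (parent u) →
      t ⊑ u → t ⊑ parent u
    climb (inj₁ refl) u≢root _ (inj₁ refl) = ⊥-elim (u≢root refl)
    climb (inj₂ ¬parent) _ parent-in-S (inj₁ refl) = ⊥-elim (¬parent parent-in-S)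
    climb _ _ _ (inj₂ d) = proj₂ (desc-parent d)

    walk-⊑ : ∀ {t u y} → t ≡ root ⊎ ¬ Holds S (parent t) → t ⊑ u → Reach (Holds S) u y → t ⊑ y
    walk-⊑ top t⊑u here = t⊑u
    walk-⊑ top t⊑u (step (inj₁ (u≢root , refl)) in-S walk) = walk-⊑ top (climb top u≢root in-S t⊑u) walk
    walk-⊑ top t⊑u (step (inj₂ (w≢root , refl)) _ walk) = walk-⊑ top (inj₂ (parent-desc t⊑u w≢root)) walk

    top-⊑ : ∀ {t y} → IsTop S t → Holds S y → t ⊑ y
    top-⊑ (in-S , top) y-in-S = walk-⊑ top (inj₁ refl) (proj₂ connected _ _ in-S y-in-S)

    top-exists : ∀ {z} → Holds S z → ∃ (IsTop S)
    top-exists {z} = parent-induction (λ z → Holds S z → ∃ (IsTop S)) up z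
      where
      up : ∀ z → (z ≢ root → Holds S (parent z) → ∃ (IsTop S)) → Holds S z → ∃ (IsTop S)
      up z ih z-in-S with z ≟ root
      ... | yes z≡root = z , z-in-S , inj₁ z≡root
      ... | no z≢root with holds? (parent z)
      ...   | yes p-in-S = ih z≢root p-in-S
      ...   | no p∉S = z , z-in-S , inj₂ p∉S

    convex : ∀ {y x z} → Holds S y → Holds S z → y ⊑ x → x ⊑ z → Holds S x
    convex {y} {z = z} y-in-S z-in-S y⊑x x⊑z =
      parent-induction (λ z → ∀ {x} → Holds S z → y ⊑ x → x ⊑ z → Holds S x) up z z-in-S y⊑x x⊑z
      where
      up : ∀ z → (z ≢ root → ∀ {x} → Holds S (parent z) → y ⊑ x → x ⊑ parent z → Holds S x) →
           ∀ {x} → Holds S z → y ⊑ x → x ⊑ z → Holds S x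
      up z ih z-in-S y⊑x (inj₁ refl) = z-in-S
      up z ih z-in-S y⊑x (inj₂ d) with desc-parent d | holds? (parent z)
      ... | z≢root , x⊑p | yes p-in-S = ih z≢root p-in-S y⊑x x⊑p
      ... | _ | no p∉S = ⊥-elim (desc-⋢ d (⊑-trans (top-⊑ (z-in-S , inj₂ p∉S) y-in-S) y⊑x))

  top-inherited : ∀ (S S′ : Subtree) {t t′ x} → IsTop S t → IsTop S′ t′ → t′ ⊑ t →
    Holds S x → Holds S′ x → Holds S′ t
  top-inherited S S′ top top′ t′⊑t x-in-S x-in-S′ =
    convex S′ (proj₁ top′) x-in-S′ t′⊑t (top-⊑ S top x-in-S)

  -- Helly property: three pairwise intersecting subtrees have a common node,
  -- namely the deepest of their three tops.
  helly : ∀ (P Q R : Subtree) →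
    (∃ λ x → Holds P x × Holds Q x) → (∃ λ y → Holds Q y × Holds R y) → (∃ λ z → Holds P z × Holds R z) →
    ∃ λ u → Holds P u × Holds Q u × Holds R u
  helly P Q R (x , px , qx) (y , qy , ry) (z , pz , rz)
    with top-exists P px | top-exists Q qy | top-exists R rz
  ... | tp , topP | tq , topQ | tr , topR
    with ⊑-comparable (top-⊑ P topP px) (top-⊑ Q topQ qx)
       | ⊑-comparable (top-⊑ Q topQ qy) (top-⊑ R topR ry)
       | ⊑-comparable (top-⊑ P topP pz) (top-⊑ R topR rz)
  ... | inj₁ p⊑q | inj₁ q⊑r | _ =
    tr , top-inherited R P topR topP (⊑-trans p⊑q q⊑r) rz pz , top-inherited R Q topR topQ q⊑r ry qy , proj₁ topR
  ... | inj₁ p⊑q | inj₂ r⊑q | _ =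
    tq , top-inherited Q P topQ topP p⊑q qx px , proj₁ topQ , top-inherited Q R topQ topR r⊑q qy ry
  ... | inj₂ q⊑p | _ | inj₁ p⊑r =
    tr , top-inherited R P topR topP p⊑r rz pz , top-inherited R Q topR topQ (⊑-trans q⊑p p⊑r) ry qy , proj₁ topR
  ... | inj₂ q⊑p | _ | inj₂ r⊑p =
    tp , proj₁ topP , top-inherited P Q topP topQ q⊑p px qx , top-inherited P R topP topR r⊑p pz rz

module Nice (G : Graph) (T : RootedTD G) (nice : IsNice G T) where

  open import Data.Nat using (suc; _+_; _≤_; _<_; z≤n; s≤s; _≟_; _≤?_)
  open import Data.Nat.Properties using (+-monoʳ-≤; +-monoˡ-≤; +-suc; ≤-pred; ≤-refl; ≤-trans; ≤-reflexive; ≤-antisym; ≤∧≢⇒<; ≰⇒>; +-comm)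
  open import Data.Fin using (Fin)
  open import Data.Fin.Properties using (any?; all?) renaming (_≟_ to _≟ᶠ_)
  open import Data.Fin.Subset using (_∈_; _∉_; _⊆_; _∩_; ∣_∣)
  open import Data.Fin.Subset.Properties using (_∈?_; ⊆-antisym; x∈p∩q⁺; p∩q⊆p; p∩q⊆q; ∣p∩q∣≤∣q∣)
  open import Data.List using (List; []; _∷_; filter; allFin)
  open import Data.List.Relation.Unary.Any using (Any; here; there)
  open import Data.List.Relation.Unary.All using ([]; _∷_)
  open import Data.List.Relation.Unary.AllPairs using ([]; _∷_)
  open import Data.List.Relation.Unary.Unique.Propositional.Properties using (filter⁺; allFin⁺)
  open import Data.List.Membership.Propositional using (find; lose)
  open import Data.List.Membership.Propositional.Properties using (∈-filter⁺; ∈-filter⁻; ∈-allFin)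
  open import Data.Product using (∃; ∃₂; ∃-syntax; _×_; _,_; proj₁; proj₂)
  open import Data.Sum using (_⊎_; inj₁; inj₂)
  open import Data.Empty using (⊥; ⊥-elim)
  open import Function using (_∘_)
  open import Function.Bundles using (Equivalence; _⇔_)
  open import Relation.Nullary using (¬_; Dec; yes; no; ¬?)
  open import Relation.Nullary.Decidable using (_×-dec_; _⊎-dec_; _→-dec_)
  open import Relation.Unary using (Decidable)
  open import Relation.Binary.PropositionalEquality using (_≡_; _≢_; refl; sym; trans; subst; subst₂)

  open Graph G using (n; Adj)
  open RootedTD T
  open Trees T
  open Subsets
  open Counting {A = Fin m} _≟ᶠ_
  open Equivalence

  edges-in-bags : ∀ v v′ → v ≢ v′ → Adj v v′ ⇔ (∃[ u ] (v ∈ bag u × v′ ∈ bag u))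
  edges-in-bags = proj₁ (proj₁ nice)

  vertex-subtrees : ∀ v → InducesSubtree (λ u → v ∈ bag u)
  vertex-subtrees = proj₂ (proj₁ nice)

  adjacent-bags-differ : ∀ u → u ≢ root → bag u ≢ bag (parent u)
  adjacent-bags-differ = proj₁ (proj₂ nice)

  small-bags-maximal : ∀ u → 3 ≤ ∣ bag u ∣ × (∣ bag u ∣ ≡ 3 → IsMaximalClique G (bag u))
  small-bags-maximal = proj₁ (proj₂ (proj₂ nice))

  large-bags-share : ∀ u → u ≢ root → 5 ≤ ∣ bag u ∣ → ∣ bag u ∣ ≤ suc ∣ bag u ∩ bag (parent u) ∣
  large-bags-share = proj₁ (proj₂ (proj₂ (proj₂ nice)))

  root-triangle : (∃[ S ] IsMaximal3Clique G S) → IsMaximal3Clique G (bag root)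
  root-triangle = proj₂ (proj₂ (proj₂ (proj₂ nice)))

  subtree-of : Fin n → Subtree
  subtree-of v = record { Holds = λ u → v ∈ bag u ; holds? = λ u → v ∈? bag u ; connected = vertex-subtrees v }

  bag-clique : ∀ u → IsClique G (bag u)
  bag-clique u v v′ v∈ v′∈ v≢v′ = from (edges-in-bags v v′ v≢v′) (u , v∈ , v′∈)

  edge-bag : ∀ {v v′} → v ≢ v′ → Adj v v′ → ∃ λ u → v ∈ bag u × v′ ∈ bag u
  edge-bag {v} {v′} v≢v′ = to (edges-in-bags v v′ v≢v′)

  triangle-bag : ∀ {a b c} → a ≢ b → a ≢ c → b ≢ c → Adj a b → Adj a c → Adj b c →
    ∃ λ u → a ∈ bag u × b ∈ bag u × c ∈ bag u
  triangle-bag {a} {b} {c} a≢b a≢c b≢c ab ac bc =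
    helly (subtree-of a) (subtree-of b) (subtree-of c) (edge-bag a≢b ab) (edge-bag b≢c bc) (edge-bag a≢c ac)

  maximal-bag-⊆ : ∀ {h u} → IsMaximalClique G (bag h) → bag h ⊆ bag u → bag u ≡ bag h
  maximal-bag-⊆ {h} {u} (_ , maximal) h⊆u = ⊆-antisym (maximal (bag u) (bag-clique u) h⊆u) h⊆u

  Tri : Fin m → Set
  Tri w = ∣ bag w ∣ ≡ 3

  tri? : Decidable Tri
  tri? w = ∣ bag w ∣ ≟ 3

  -- By nice (1), the bag of a triangle node is not contained in the bag of a neighbour.
  parent-misses-triangle : ∀ {h} → Tri h → h ≢ root → ¬ bag h ⊆ bag (parent h)
  parent-misses-triangle {h} tri h≢root h⊆p =
    adjacent-bags-differ h h≢root (sym (maximal-bag-⊆ (proj₂ (small-bags-maximal h) tri) h⊆p))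

  child-misses-triangle : ∀ {h c} → Tri h → Child h c → ¬ bag h ⊆ bag c
  child-misses-triangle {h} tri (c≢root , refl) h⊆c =
    adjacent-bags-differ _ c≢root (maximal-bag-⊆ (proj₂ (small-bags-maximal h) tri) h⊆c)

  three-in-child : ∀ {h c a b d} → Tri h → Child h c → a ≢ b → a ≢ d → b ≢ d →
    a ∈ bag h → b ∈ bag h → d ∈ bag h → a ∈ bag c → b ∈ bag c → d ∈ bag c → ⊥
  three-in-child tri ch a≢b a≢d b≢d a∈h b∈h d∈h a∈c b∈c d∈c =
    child-misses-triangle tri ch (triangle-⊆ tri a≢b a≢d b≢d a∈h b∈h d∈h a∈c b∈c d∈c)

  maximal-triangle-bag : ∀ {S} → IsMaximal3Clique G S → ∃ λ u → bag u ≡ S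
  maximal-triangle-bag {S} ((clique , maximal) , ∣S∣≡3)
    with some-element {p = S} (subst (0 <_) (sym ∣S∣≡3) (s≤s z≤n))
  ... | a , a∈S with three-elements ∣S∣≡3 a∈S
  ... | b , c , b∈S , c∈S , a≢b , a≢c , b≢c
    with triangle-bag a≢b a≢c b≢c (clique a b a∈S b∈S a≢b) (clique a c a∈S c∈S a≢c) (clique b c b∈S c∈S b≢c)
  ... | u , a∈u , b∈u , c∈u = u , ⊆-antisym (maximal (bag u) (bag-clique u) S⊆u) S⊆u
    where
    S⊆u : S ⊆ bag u
    S⊆u = triangle-⊆ ∣S∣≡3 a≢b a≢c b≢c a∈S b∈S c∈S a∈u b∈u c∈u

  ReachesTri : Fin m → Set
  ReachesTri h = ∃ λ w → h ⊑ w × Tri w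

  reachesTri? : Decidable ReachesTri
  reachesTri? h = any? (λ w → ⊑? h w ×-dec tri? w)

  Branch : Fin m → Set
  Branch = IsBranchRoot G T

  branch? : Decidable Branch
  branch? r = (∣ bag r ∣ ≟ 4) ×-dec ¬? (r ≟ᶠ root) ×-dec (∣ bag r ∩ bag (parent r) ∣ ≟ 2)
              ×-dec all? (λ w → desc? r w →-dec ¬? (tri? w))

  -- The children that matter for counting: those reaching a triangle, and branch roots.
  GoodChild : Fin m → Fin m → Set
  GoodChild h c = Child h c × (ReachesTri c ⊎ Branch c)

  goodChild? : ∀ h → Decidable (GoodChild h)
  goodChild? h c = child? h c ×-dec (reachesTri? c ⊎-dec branch? c)

  -- A child of a triangle node sharing an edge with it, with no triangle node in
  -- its subtree, is a branch root: its bag has exactly four vertices by nice (2)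
  -- and (3), and shares exactly the edge with the parent triangle.
  branch-child : ∀ {h c a b} → Tri h → Child h c → a ≢ b → a ∈ bag h → b ∈ bag h →
    a ∈ bag c → b ∈ bag c → ¬ ReachesTri c → Branch c
  branch-child {h} {c} {a} {b} tri ch@(c≢root , refl) a≢b a∈h b∈h a∈c b∈c ¬reach =
    ≤-antisym size≤4 4≤size , c≢root , ≤-antisym shared≤2 2≤shared , λ w d tri-w → ¬reach (w , inj₂ d , tri-w)
    where
    shared≤2 : ∣ bag c ∩ bag h ∣ ≤ 2
    shared≤2 with 3 ≤? ∣ bag c ∩ bag h ∣
    ... | no ¬3≤ = ≤-pred (≰⇒> ¬3≤)
    ... | yes 3≤ = ⊥-elim (child-misses-triangle tri ch
          (p∩q⊆p (bag c) (bag h) ∘ ⊆-by-card (p∩q⊆q (bag c) (bag h)) (subst (_≤ ∣ bag c ∩ bag h ∣) (sym tri) 3≤)))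

    2≤shared : 2 ≤ ∣ bag c ∩ bag h ∣
    2≤shared = length-≤-card (bag c ∩ bag h) ((a≢b ∷ []) ∷ [] ∷ [])
      λ { (here refl) → x∈p∩q⁺ (a∈c , a∈h) ; (there (here refl)) → x∈p∩q⁺ (b∈c , b∈h) }

    size≤4 : ∣ bag c ∣ ≤ 4
    size≤4 with 5 ≤? ∣ bag c ∣
    ... | no ¬5≤ = ≤-pred (≰⇒> ¬5≤)
    ... | yes 5≤ = ≤-trans (large-bags-share c c≢root 5≤) (s≤s (≤-trans (∣p∩q∣≤∣q∣ (bag c) (bag h)) (≤-reflexive tri)))

    4≤size : 4 ≤ ∣ bag c ∣
    4≤size = ≤∧≢⇒< (proj₁ (small-bags-maximal c)) (λ 3≡size → ¬reach (c , inj₁ refl , sym 3≡size))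

  one-exit : ∀ {h} → ¬ Tri h → ReachesTri h → AtLeast (GoodChild h) 1
  one-exit ¬tri (w , h⊑w , tri-w) with child-split (⊑-≢ h⊑w λ { refl → ¬tri tri-w })
  ... | c , ch , c⊑w = atLeast-one (ch , inj₁ (w , c⊑w , tri-w))

  triangle-nodes : ∀ {t} → HasMaximal3Cliques G t → AtLeast Tri t
  triangle-nodes (L , unique , maximal-iff , refl) =
    atLeast-map (λ {u} bag∈L → proj₂ (to (maximal-iff (bag u)) bag∈L))
      (atLeast-preimage bag L unique (λ S S∈L → maximal-triangle-bag (to (maximal-iff S) S∈L)))

  root-is-triangle : ∀ {t} → 1 ≤ t → HasMaximal3Cliques G t → Tri root
  root-is-triangle () ([] , _ , _ , refl)
  root-is-triangle _ (S ∷ _ , _ , maximal-iff , _) = proj₂ (root-triangle (S , to (maximal-iff S) (here refl)))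

  module WithFourCliques (four-cliques : ∀ u v → Adj u v → ∃[ S ] (IsKClique G 4 S × u ∈ S × v ∈ S)) where

    -- An edge of a triangle bag also lies in another bag: extend it to a 4-clique,
    -- pick a fourth vertex x outside the triangle, and put the triangle abx in a bag.
    other-bag : ∀ {h a b} → Tri h → a ≢ b → a ∈ bag h → b ∈ bag h → ∃ λ u → a ∈ bag u × b ∈ bag u × u ≢ h
    other-bag {h} {a} {b} tri a≢b a∈h b∈h with four-cliques a b (bag-clique h a b a∈h b∈h a≢b)
    ... | S , (clique , ∣S∣≡4) , a∈S , b∈S
      with card-witness {p = S} {q = bag h} (subst₂ _<_ (sym tri) (sym ∣S∣≡4) ≤-refl)
    ... | x , x∈S , x∉h
      with triangle-bag a≢b a≢x b≢x (bag-clique h a b a∈h b∈h a≢b) (clique a x a∈S x∈S a≢x) (clique b x b∈S x∈S b≢x)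
      where
      a≢x : a ≢ x
      a≢x refl = x∉h a∈h
      b≢x : b ≢ x
      b≢x refl = x∉h b∈h
    ... | u , a∈u , b∈u , x∈u = u , a∈u , b∈u , λ { refl → x∉h x∈u }

    Exit : Fin m → Fin n → Fin n → Set
    Exit h a b = ∃ λ c → GoodChild h c × a ∈ bag c × b ∈ bag c

    exit : ∀ {h a b} → Tri h → a ≢ b → a ∈ bag h → b ∈ bag h → IsTop (subtree-of a) h → Exit h a b
    exit {h} {a} {b} tri a≢b a∈h b∈h top = through-child (other-bag tri a≢b a∈h b∈h)
      where
      through-child : (∃ λ u → a ∈ bag u × b ∈ bag u × u ≢ h) → Exit h a b
      through-child (u , a∈u , b∈u , u≢h) = via (child-split (⊑-≢ h⊑u u≢h))
        where
        h⊑u : h ⊑ u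
        h⊑u = top-⊑ (subtree-of a) top a∈u
        via : (∃ λ c → Child h c × c ⊑ u) → Exit h a b
        via (c , ch , c⊑u) = c , (ch , good (reachesTri? c)) , a∈c , b∈c
          where
          h⊑c : h ⊑ c
          h⊑c = inj₂ (child-desc ch)
          a∈c : a ∈ bag c
          a∈c = convex (subtree-of a) a∈h a∈u h⊑c c⊑u
          b∈c : b ∈ bag c
          b∈c = convex (subtree-of b) b∈h b∈u h⊑c c⊑u
          good : Dec (ReachesTri c) → ReachesTri c ⊎ Branch c
          good (yes reach) = inj₁ reach
          good (no ¬reach) = inj₂ (branch-child tri ch a≢b a∈h b∈h a∈c b∈c ¬reach)

    -- Some vertex of a triangle bag has the top of its subtree at that node:
    -- any vertex missing from the parent's bag, or any vertex at all at the root.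
    top-vertex : ∀ {h} → Tri h → ∃ λ a → IsTop (subtree-of a) h
    top-vertex {h} tri with h ≟ᶠ root
    ... | yes h≡root with some-element {p = bag h} (subst (0 <_) (sym tri) (s≤s z≤n))
    ...   | a , a∈h = a , a∈h , inj₁ h≡root
    top-vertex {h} tri | no h≢root with ⊈-witness (parent-misses-triangle tri h≢root)
    ...   | a , a∈h , a∉p = a , a∈h , inj₂ a∉p

    -- A triangle node has two good children: the exits of the two triangle edges at
    -- a top vertex, which differ since no child contains the whole triangle.
    two-exits : ∀ {h} → Tri h → AtLeast (GoodChild h) 2
    two-exits {h} tri = from-top (top-vertex tri)
      where
      from-top : (∃ λ a → IsTop (subtree-of a) h) → AtLeast (GoodChild h) 2
      from-top (a , top@(a∈h , _)) = from-others (three-elements tri a∈h)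
        where
        from-others : (∃₂ λ b d → b ∈ bag h × d ∈ bag h × a ≢ b × a ≢ d × b ≢ d) → AtLeast (GoodChild h) 2
        from-others (b , d , b∈h , d∈h , a≢b , a≢d , b≢d) =
          distinct (exit tri a≢b a∈h b∈h top) (exit tri a≢d a∈h d∈h top)
          where
          distinct : Exit h a b → Exit h a d → AtLeast (GoodChild h) 2
          distinct (c₁ , good₁ , a∈c₁ , b∈c₁) (c₂ , good₂ , _ , d∈c₂) =
            atLeast-two (λ { refl → three-in-child tri (proj₁ good₁) a≢b a≢d b≢d a∈h b∈h d∈h a∈c₁ b∈c₁ d∈c₂ })
              good₁ good₂

    -- At the root every vertex is a top vertex, so all three edges give exits.
    three-exits : Tri root → AtLeast (GoodChild root) 3
    three-exits tri = from-vertex (some-element {p = bag root} (subst (0 <_) (sym tri) (s≤s z≤n)))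
      where
      from-vertex : (∃ λ a → a ∈ bag root) → AtLeast (GoodChild root) 3
      from-vertex (a , a∈r) = from-others (three-elements tri a∈r)
        where
        from-others : (∃₂ λ b d → b ∈ bag root × d ∈ bag root × a ≢ b × a ≢ d × b ≢ d) →
          AtLeast (GoodChild root) 3
        from-others (b , d , b∈r , d∈r , a≢b , a≢d , b≢d) =
          distinct (exit tri a≢b a∈r b∈r (a∈r , inj₁ refl)) (exit tri a≢d a∈r d∈r (a∈r , inj₁ refl))
                   (exit tri b≢d b∈r d∈r (b∈r , inj₁ refl))
          where
          distinct : Exit root a b → Exit root a d → Exit root b d → AtLeast (GoodChild root) 3
          distinct (c₁ , good₁ , a∈c₁ , b∈c₁) (c₂ , good₂ , a∈c₂ , d∈c₂) (c₃ , good₃ , b∈c₃ , d∈c₃) =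
            atLeast-three
              (λ { refl → three-in-child tri (proj₁ good₁) a≢b a≢d b≢d a∈r b∈r d∈r a∈c₁ b∈c₁ d∈c₂ })
              (λ { refl → three-in-child tri (proj₁ good₁) a≢b a≢d b≢d a∈r b∈r d∈r a∈c₁ b∈c₁ d∈c₃ })
              (λ { refl → three-in-child tri (proj₁ good₂) a≢b a≢d b≢d a∈r b∈r d∈r a∈c₂ b∈c₃ d∈c₂ })
              good₁ good₂ good₃

    Claim : Fin m → Set
    Claim h = ReachesTri h → ∀ k → AtLeast (λ w → Tri w × h ⊑ w) k →
      AtLeast (λ r → Branch r × Desc h r) (suc k)

    -- Summing the claim over the (disjoint) subtrees of the good children of h: every
    -- good child adds one branch root beyond the triangle nodes of its subtree.
    below-bound : ∀ {h} → (∀ c → GoodChild h c → Claim c) → ∀ {e} → AtLeast (GoodChild h) e →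
      ∀ k → AtLeast (λ w → Tri w × Desc h w) k → AtLeast (λ r → Branch r × Desc h r) (k + e)
    below-bound {h} ih exits k tris =
      atLeast-weaken (+-monoʳ-≤ k (atLeast-≤ children exits (λ c gc → ∈-filter⁺ (goodChild? h) (∈-allFin c) gc)))
        (atLeast-map leave
          (gather (GoodChild h) _⊑_ ⊑? disjoint contribution
            children (filter⁺ (goodChild? h) (allFin⁺ m)) (λ _ → proj₂ ∘ ∈-filter⁻ (goodChild? h) {xs = allFin m})
            k (atLeast-map enter tris)))
      where
      children : List (Fin m)
      children = filter (goodChild? h) (allFin m)

      disjoint : ∀ {c c′ x} → GoodChild h c → GoodChild h c′ → c ≢ c′ → c ⊑ x → c′ ⊑ x → ⊥
      disjoint (ch , _) (ch′ , _) = children-disjoint ch ch′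

      -- a branch-root child has no triangle node in its subtree and counts itself
      contribution : ∀ {c} → GoodChild h c → ∀ k → AtLeast (λ w → Tri w × c ⊑ w) k →
        AtLeast (λ r → Branch r × c ⊑ r) (suc k)
      contribution {c} gc@(_ , inj₁ reach) k tris = atLeast-map (λ (br , d) → br , inj₂ d) (ih c gc reach k tris)
      contribution {c} (_ , inj₂ branch@(size4 , _ , _ , no-tri)) k tris
        with atLeast-none (λ { (tri , inj₁ refl) → 3≢4 (trans (sym tri) size4) ; (tri , inj₂ d) → no-tri _ d tri }) tris
        where
        3≢4 : 3 ≢ 4
        3≢4 ()
      ... | refl = atLeast-one (branch , inj₁ refl)

      enter : ∀ {w} → Tri w × Desc h w → Tri w × Any (λ c → c ⊑ w) children
      enter {w} (tri , d) with child-split d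
      ... | c , ch , c⊑w = tri , lose (∈-filter⁺ (goodChild? h) (∈-allFin c) (ch , inj₁ (w , c⊑w , tri))) c⊑w

      leave : ∀ {r} → Branch r × Any (λ c → c ⊑ r) children → Branch r × Desc h r
      leave (br , inside) with find inside
      ... | c , c∈ , c⊑r = br , desc-⊑-trans (child-desc (proj₁ (proj₂ (∈-filter⁻ (goodChild? h) {xs = allFin m} c∈)))) c⊑r

    triangle-bound : ∀ {h} → (∀ c → GoodChild h c → Claim c) → ∀ {e} → AtLeast (GoodChild h) (suc e) →
      ∀ {k} → AtLeast (λ w → Tri w × h ⊑ w) k → AtLeast (λ r → Branch r × Desc h r) (k + e)
    triangle-bound {h} ih {e} exits tris with atLeast-remove h tris
    ... | k′ , others , k≤ =
      atLeast-weaken (≤-trans (+-monoˡ-≤ e k≤) (≤-reflexive (sym (+-suc k′ e))))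
        (below-bound ih exits k′ (atLeast-map (λ ((tri , h⊑w) , w≢h) → tri , ⊑-≢ h⊑w w≢h) others))

    -- The claim at h follows from the claim at its good children: a triangle node has
    -- two good children, any other node reaching a triangle has one.
    claim-step : ∀ {h} → (∀ c → GoodChild h c → Claim c) → Claim h
    claim-step {h} ih reach k tris with tri? h
    ... | yes tri = atLeast-weaken (≤-reflexive (+-comm 1 k)) (triangle-bound ih (two-exits tri) tris)
    ... | no ¬tri = atLeast-weaken (≤-reflexive (+-comm 1 k))
      (below-bound ih (one-exit ¬tri reach) k (atLeast-map (λ (tri , h⊑w) → tri , ⊑-≢ h⊑w λ { refl → ¬tri tri }) tris))

    claim : ∀ h → Claim h
    claim = child-induction Claim λ h ih → claim-step λ c (ch , _) → ih c ch

-- The root is a triangle node with three good children; the t triangle nodes all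
-- lie in its subtree, so below it there are at least t + 2 branch roots.
proposition7 : (G : Graph) → Is4Chordal G → (t : ℕ) → 1 ≤ t → HasMaximal3Cliques G t →
               (T : RootedTD G) → IsNice G T → HasAtLeastBranches G T (t + 2)
proposition7 G (_ , four-cliques) t 1≤t cliques T nice =
  atLeast-map proj₁
    (triangle-bound (λ c _ → claim c) (three-exits root-tri)
      (atLeast-map (λ tri → tri , root-⊑ _) (triangle-nodes cliques)))
  where
  open RootedTD T using (m; root)
  open Counting {A = Fin m} _≟ᶠ_ using (atLeast-map)
  open Trees T using (root-⊑)
  open Nice G T nice
  open WithFourCliques four-cliques

  root-tri : Tri root
  root-tri = root-is-triangle 1≤t cliques
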